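{- Let $D$ be a deck of order $n$ with symbol set $S$ and $c$ cards. If there do not exist $n$ distinct symbols $s_1,\dots,s_n\in S$ with $\sum_{i=1}^n m(s_i)=c$, then $D$ is maximal.
   Context: A deck consists of a finite set $S$ of symbols together with a finite collection $D$ of distinct cards, each card being a subset of $S$, satisfying: (D1) any two distinct cards have exactly one symbol in common; (D2) every symbol of $S$ lies on at least two cards; (D3) every card contains at least two symbols; (D4) all cards have the same cardinality $n$ (the order); (D5) $S$ is nonempty. $c=|D|$. For $s\in S$, the multiplicity $m(s)$ is the number of cards containing $s$. A deck $D$ is maximal if there is no new card $\Gamma\subseteq S$, $\Gamma\notin D$, such that $D\cup\{\Gamma\}$ (with the same symbol set $S$) is still a deck. -}

module Defs where

open import Data.Nat using (ℕ; _≤_)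
open import Data.Fin using (Fin)
open import Data.Fin.Subset using (Subset; _∩_; ∣_∣) renaming (_∈_ to _∈ₛ_)
open import Data.Fin.Subset.Properties using (_∈?_)
open import Data.List using (List; _∷_; length; filter)
open import Data.List.Membership.Propositional using (_∈_; _∉_)
open import Data.List.Relation.Unary.Unique.Propositional using (Unique)
open import Data.Product using (Σ; _×_)
open import Relation.Binary.PropositionalEquality using (_≡_; _≢_)
open import Relation.Nullary using (¬_)

-- Symbols are S = Fin k; a card is a subset of S; a collection of cards is a
-- list (distinctness is imposed by Unique).

mult : ∀ {k} → List (Subset k) → Fin k → ℕ
mult D s = length (filter (s ∈?_) D)

record Deck (k n : ℕ) (D : List (Subset k)) : Set where
  field
    distinct : Unique D
    D1 : ∀ {a b} → a ∈ D → b ∈ D → a ≢ b → ∣ a ∩ b ∣ ≡ 1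
    D2 : ∀ (s : Fin k) → 2 ≤ mult D s
    D3 : ∀ {a} → a ∈ D → 2 ≤ ∣ a ∣
    D4 : ∀ {a} → a ∈ D → ∣ a ∣ ≡ n
    D5 : 1 ≤ k

Maximal : (k : ℕ) → List (Subset k) → Set
Maximal k D = ∀ (Γ : Subset k) → Γ ∉ D → ¬ (Σ ℕ λ n′ → Deck k n′ (Γ ∷ D))

-- A card Γ that could be added to D meets every card of D in exactly one
-- symbol, so counting the pairs (symbol of Γ, card of D containing it) gives
-- Σ_{s ∈ Γ} m(s) = c; and Γ has n symbols because it has the order of the
-- cards of D.  Listing the symbols of Γ produces the forbidden n symbols.
module Submission where

open import Defs
open import Algebra.Properties.CommutativeSemigroup using (interchange)
open import Data.Bool using (true; false; if_then_else_)
open import Data.Fin using (Fin; zero; suc)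
import Data.Fin as Fin
open import Data.Fin.Properties using (suc-injective)
open import Data.Fin.Subset using (Subset; inside; outside; _∩_; ∣_∣)
open import Data.Fin.Subset.Properties using (_∈?_)
open import Data.Vec using ([]; _∷_)
open import Data.List using (List; []; _∷_; length; map; allFin; lookup; tabulate)
open import Data.List.Membership.Propositional using (_∈_; _∉_)
open import Data.List.Membership.Propositional.Properties using (∈-lookup)
open import Data.List.Properties using (map-cong; map-∘; length-map; map-tabulate; tabulate-lookup)
open import Data.List.Relation.Unary.All as All using (All; []; _∷_)
open import Data.List.Relation.Unary.AllPairs using ([]; _∷_)
open import Data.List.Relation.Unary.Any using (here; there)
open import Data.List.Relation.Unary.Unique.Propositional using (Unique)
open import Data.List.Relation.Unary.Unique.Propositional.Properties using (map⁺)
open import Data.Nat using (ℕ; zero; suc; _+_; _≤_)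
open import Data.Nat.ListAction using (sum)
open import Data.Nat.Properties using (+-commutativeSemigroup)
open import Data.Product using (Σ; ∃; _×_; _,_)
open import Data.Empty using (⊥-elim)
open import Function using (id; _∘_)
open import Function.Definitions using (Injective)
open import Relation.Binary.PropositionalEquality
open import Relation.Nullary using (¬_; does)

private
  variable
    k n n′ : ℕ
    D : List (Subset k)
    Γ : Subset k
    A : Set

elements : Subset k → List (Fin k)
elements []          = []
elements (true ∷ p)  = zero ∷ map suc (elements p)
elements (false ∷ p) = map suc (elements p)

length-elements : (p : Subset k) → length (elements p) ≡ ∣ p ∣
length-elements []          = refl
length-elements (true ∷ p)  = cong suc (trans (length-map suc (elements p)) (length-elements p))
length-elements (false ∷ p) = trans (length-map suc (elements p)) (length-elements p)

zero∉map-suc : (xs : List (Fin k)) → All (Fin.zero {k} ≢_) (map Fin.suc xs)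
zero∉map-suc []       = []
zero∉map-suc (x ∷ xs) = (λ ()) ∷ zero∉map-suc xs

elements-unique : (p : Subset k) → Unique (elements p)
elements-unique []          = []
elements-unique (true ∷ p)  = zero∉map-suc (elements p) ∷ map⁺ suc-injective (elements-unique p)
elements-unique (false ∷ p) = map⁺ suc-injective (elements-unique p)

lookup-injective : {xs : List A} → Unique xs → Injective _≡_ _≡_ (lookup xs)
lookup-injective (_ ∷ _)    {zero}  {zero}  _  = refl
lookup-injective (x∉ ∷ _)   {zero}  {suc j} eq = ⊥-elim (All.lookup x∉ (∈-lookup j) eq)
lookup-injective (x∉ ∷ _)   {suc i} {zero}  eq = ⊥-elim (All.lookup x∉ (∈-lookup i) (sym eq))
lookup-injective (_ ∷ uniq) {suc i} {suc j} eq = cong suc (lookup-injective uniq eq)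

indexing-of-unique : (xs : List A) → Unique xs → length xs ≡ n → (f : A → ℕ) →
  Σ (Fin n → A) λ s → Injective _≡_ _≡_ s × sum (map (λ i → f (s i)) (allFin n)) ≡ sum (map f xs)
indexing-of-unique xs uniq refl f = lookup xs , lookup-injective uniq , cong sum reindex
  where
  open ≡-Reasoning
  reindex : map (λ i → f (lookup xs i)) (allFin (length xs)) ≡ map f xs
  reindex = begin
    map (λ i → f (lookup xs i)) (tabulate id) ≡⟨ map-tabulate id (λ i → f (lookup xs i)) ⟩
    tabulate (λ i → f (lookup xs i))          ≡⟨ map-tabulate (lookup xs) f ⟨
    map f (tabulate (lookup xs))              ≡⟨ cong (map f) (tabulate-lookup xs) ⟩
    map f xs                                  ∎

subset-indexing : (Γ : Subset k) → ∣ Γ ∣ ≡ n → (f : Fin k → ℕ) →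
  Σ (Fin n → Fin k) λ s → Injective _≡_ _≡_ s × sum (map (λ i → f (s i)) (allFin n)) ≡ sum (map f (elements Γ))
subset-indexing Γ ∣Γ∣≡n =
  indexing-of-unique (elements Γ) (elements-unique Γ) (trans (length-elements Γ) ∣Γ∣≡n)

sum-map-+ : (f g : A → ℕ) (xs : List A) →
  sum (map (λ x → f x + g x) xs) ≡ sum (map f xs) + sum (map g xs)
sum-map-+ f g []       = refl
sum-map-+ f g (x ∷ xs) = trans (cong (f x + g x +_) (sum-map-+ f g xs))
  (interchange +-commutativeSemigroup (f x) (g x) (sum (map f xs)) (sum (map g xs)))

sum-map-0 : (xs : List A) → sum (map (λ _ → 0) xs) ≡ 0
sum-map-0 []       = refl
sum-map-0 (_ ∷ xs) = sum-map-0 xs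

indicator : Subset k → Fin k → ℕ
indicator a x = if does (x ∈? a) then 1 else 0

mult-∷ : (a : Subset k) (D : List (Subset k)) (x : Fin k) →
  mult (a ∷ D) x ≡ indicator a x + mult D x
mult-∷ a D x with does (x ∈? a)
... | true  = refl
... | false = refl

sum-indicator-elements : (p a : Subset k) → sum (map (indicator a) (elements p)) ≡ ∣ p ∩ a ∣
sum-indicator-map-suc : ∀ b (p a : Subset k) →
  sum (map (indicator (b ∷ a)) (map suc (elements p))) ≡ ∣ p ∩ a ∣

sum-indicator-elements []          []            = refl
sum-indicator-elements (true ∷ p)  (inside ∷ a)  = cong suc (sum-indicator-map-suc inside p a)
sum-indicator-elements (true ∷ p)  (outside ∷ a) = sum-indicator-map-suc outside p a
sum-indicator-elements (false ∷ p) (b ∷ a)       = sum-indicator-map-suc b p a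

sum-indicator-map-suc b p a = trans (cong sum (sym (map-∘ (elements p)))) (sum-indicator-elements p a)

MeetsEachOnce : Subset k → List (Subset k) → Set
MeetsEachOnce Γ D = ∀ {a} → a ∈ D → ∣ Γ ∩ a ∣ ≡ 1

sum-mult-elements : (Γ : Subset k) (D : List (Subset k)) → MeetsEachOnce Γ D →
  sum (map (mult D) (elements Γ)) ≡ length D
sum-mult-elements Γ []      _    = sum-map-0 (elements Γ)
sum-mult-elements Γ (a ∷ D) once = begin
  sum (map (mult (a ∷ D)) (elements Γ))
    ≡⟨ cong sum (map-cong (mult-∷ a D) (elements Γ)) ⟩
  sum (map (λ x → indicator a x + mult D x) (elements Γ))
    ≡⟨ sum-map-+ (indicator a) (mult D) (elements Γ) ⟩
  sum (map (indicator a) (elements Γ)) + sum (map (mult D) (elements Γ))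
    ≡⟨ cong₂ _+_ (trans (sum-indicator-elements Γ a) (once (here refl)))
                 (sum-mult-elements Γ D (once ∘ there)) ⟩
  suc (length D) ∎
  where open ≡-Reasoning

deck-has-card : Deck k n D → ∃ (_∈ D)
deck-has-card {k = zero} deck with () ← Deck.D5 deck
deck-has-card {k = suc _} {D = D} deck = card-of D (Deck.D2 deck zero)
  where
  card-of : ∀ D {x} → 2 ≤ mult D x → ∃ (_∈ D)
  card-of (a ∷ _) _ = a , here refl

extension-order : Deck k n D → Deck k n′ (Γ ∷ D) → ∣ Γ ∣ ≡ n
extension-order deck deck′ with a , a∈D ← deck-has-card deck =
  trans (Deck.D4 deck′ (here refl)) (trans (sym (Deck.D4 deck′ (there a∈D))) (Deck.D4 deck a∈D))

extension-meetsEachOnce : Deck k n′ (Γ ∷ D) → Γ ∉ D → MeetsEachOnce Γ D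
extension-meetsEachOnce {D = D} deck′ Γ∉D a∈D =
  Deck.D1 deck′ (here refl) (there a∈D) (λ Γ≡a → Γ∉D (subst (_∈ D) (sym Γ≡a) a∈D))

mainTheorem18 : ∀ (k n : ℕ) (D : List (Subset k)) → Deck k n D
                → ¬ (Σ (Fin n → Fin k) λ s → Injective _≡_ _≡_ s × sum (map (λ i → mult D (s i)) (allFin n)) ≡ length D)
                → Maximal k D
mainTheorem18 k n D deck no-symbols Γ Γ∉D (_ , deck′)
  with s , s-injective , s-sum ← subset-indexing Γ (extension-order deck deck′) (mult D) =
  no-symbols (s , s-injective , trans s-sum (sum-mult-elements Γ D (extension-meetsEachOnce deck′ Γ∉D)))
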